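{- Let $G$ be a finite connected graph with clique number $\omega(G)$, and let $\mathcal{Q}(G)$ denote the set of largest cliques of $G$ (cliques with exactly $\omega(G)$ vertices). For a clique $Q$ of $G$, let $\delta_G(Q)$ and $\Delta_G(Q)$ denote the minimum and maximum, respectively, of the degrees $d_G(u)$ in $G$ over the vertices $u\in V(Q)$. Then $$\eta_{dl}(G) \ge \max_{Q\in \mathcal{Q}(G)}\left\lceil \frac{2\delta_G(Q) - \Delta_G(Q)+1}{\Delta_G(Q) - \omega(G) + 2}\right\rceil\,.$$
   Context: For a graph $G$, $N(u)$ denotes the open neighborhood of a vertex $u$ and $d_G(u)$ its degree. Given a vertex labeling $\ell: V(G)\to \mathbb{N}$ (positive integers), the $d$-lucky sum of $u$ is $d_\ell(u) = d_G(u) + \sum_{v\in N(u)}\ell(v)$. The labeling $\ell$ is a $d$-lucky labeling if $d_\ell(u)\neq d_\ell(v)$ for every edge $uv\in E(G)$. The $d$-lucky number $\eta_{dl}(G)$ is the least positive integer $k$ such that $G$ admits a $d$-lucky labeling $V(G)\to\{1,\dots,k\}$. -}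

module Defs where

open import Data.Nat using (ℕ; zero; suc; _+_; _*_; _∸_; _≤_; _<_)
open import Data.Bool using (Bool; true; false; if_then_else_)
open import Data.Fin using (Fin)
open import Data.Fin.Subset using (Subset; _∈_; ∣_∣)
open import Data.List using (List; map; allFin)
open import Data.Nat.ListAction using (sum)
open import Data.Integer as ℤ using (ℤ; +_)
open import Data.Rational using (ℚ; _/_; ceiling)
open import Data.Product using (Σ; _×_; ∃)
open import Relation.Binary.PropositionalEquality using (_≡_; _≢_)
open import Relation.Nullary using (¬_)

record Graph (n : ℕ) : Set where
  field
    Adj   : Fin n → Fin n → Bool
    sym   : ∀ u v → Adj u v ≡ Adj v u
    loopless : ∀ u → Adj u u ≡ false

open Graph public

deg : ∀ {n} → Graph n → Fin n → ℕ
deg G u = sum (map (λ v → if Adj G u v then 1 else 0) (allFin _))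

data Reach {n} (G : Graph n) (u : Fin n) : Fin n → Set where
  here : Reach G u u
  step : ∀ {v w} → Reach G u v → Adj G v w ≡ true → Reach G u w

Connected : ∀ {n} → Graph n → Set
Connected {n} G = (0 < n) × (∀ u v → Reach G u v)

IsClique : ∀ {n} → Graph n → Subset n → Set
IsClique G Q = ∀ u v → u ∈ Q → v ∈ Q → u ≢ v → Adj G u v ≡ true

-- a largest clique (its size is the clique number ω(G))
IsLargestClique : ∀ {n} → Graph n → Subset n → Set
IsLargestClique G Q = IsClique G Q × (∀ S → IsClique G S → ∣ S ∣ ≤ ∣ Q ∣)

IsMinDegOn : ∀ {n} → Graph n → Subset n → ℕ → Set
IsMinDegOn G Q δ = (∃ λ u → u ∈ Q × deg G u ≡ δ) × (∀ u → u ∈ Q → δ ≤ deg G u)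

IsMaxDegOn : ∀ {n} → Graph n → Subset n → ℕ → Set
IsMaxDegOn G Q Δ = (∃ λ u → u ∈ Q × deg G u ≡ Δ) × (∀ u → u ∈ Q → deg G u ≤ Δ)

luckySum : ∀ {n} → Graph n → (Fin n → ℕ) → Fin n → ℕ
luckySum G ℓ u = deg G u + sum (map (λ v → if Adj G u v then ℓ v else 0) (allFin _))

IsDLuckyLabeling : ∀ {n} → Graph n → ℕ → (Fin n → ℕ) → Set
IsDLuckyLabeling G k ℓ =
  (∀ v → 1 ≤ ℓ v × ℓ v ≤ k) ×
  (∀ u v → Adj G u v ≡ true → luckySum G ℓ u ≢ luckySum G ℓ v)

HasDLuckyLabeling : ∀ {n} → Graph n → ℕ → Set
HasDLuckyLabeling G k = Σ _ (IsDLuckyLabeling G k)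

IsDLuckyNumber : ∀ {n} → Graph n → ℕ → Set
IsDLuckyNumber G η = 1 ≤ η × HasDLuckyLabeling G η × (∀ k → 1 ≤ k → k < η → ¬ HasDLuckyLabeling G k)

-- ⌈ a / d ⌉ for d > 0 (the value at d = 0 is an unused junk value 0)
ceilDiv : ℤ → ℕ → ℤ
ceilDiv a zero = + 0
ceilDiv a (suc d) = ceiling (a / suc d)

module Submission where

-- Let ℓ be a d-lucky labeling with labels in {1,…,η} and Q a clique with ω vertices whose
-- degrees lie in [δ, Δ].  For u ∈ Q let D(u) be the number and R(u) the total label of the
-- neighbours of u outside Q.  Every other vertex of Q is adjacent to u, hence
--   d_ℓ(u) + 1 + η = ω + Σ_{v ∈ Q} ℓ(v) + excess(u),   excess(u) = D(u) + R(u) + (η − ℓ(u)),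
-- where only the last summand depends on u.  Vertices of Q are pairwise adjacent, so their
-- lucky sums, hence their excesses, are pairwise distinct.  As D(u) = d(u) + 1 − ω lies in
-- [s, M] with s = δ + 1 − ω, M = Δ + 1 − ω, and D ≤ R ≤ η D, all excesses lie in
-- [2s, M + ηM + η).  Pigeonhole gives ω + 2s ≤ M + ηM + η, i.e. 2δ + 1 − Δ ≤ η (Δ + 2 − ω),
-- and taking ceilings gives the theorem.

-- Graph's record field `sym` would clash with symmetry of _≡_.
open import Defs hiding (sym)
open import Data.Nat using (ℕ)
open import Data.Fin.Subset using (Subset)

module CeilingBound where
  open import Data.Nat using (ℕ; suc)
  open import Data.Integer as ℤ using (ℤ; +_; -_; _*_; _≤_; _<_; -[1+_]; +[1+_])
  open import Data.Integer.Base using (_/ℕ_) renaming (_/_ to _div_; suc to 1+_)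
  open import Data.Integer.Properties
    using (pred-suc; i<j⇒i≤pred[j]; *-cancelʳ-<-nonNeg; *-cancelʳ-≤-pos; ≤-<-trans; *-assoc;
           neg-mono-≤; neg-involutive; neg-distribˡ-*; module ≤-Reasoning)
  open import Data.Integer.DivMod using (div-pos-is-/ℕ; n<s[n/ℕd]*d)
  open import Data.Rational using (ℚ; mkℚ; ↥_; ↧_; _/_; ceiling)
  open import Data.Rational.Properties using (↥-/; ↧-/)
  import Data.Nat.GCD as ℕ
  open import Data.Sum using (inj₂)
  open import Data.Empty using (⊥-elim)
  open import Relation.Binary.PropositionalEquality

  ≤-floorDiv : ∀ (k m : ℤ) (d : ℕ) → k * + suc d ≤ m → k ≤ m div + suc d
  ≤-floorDiv k m d kd≤m =
    subst (k ≤_) (trans (pred-suc q) (sym (div-pos-is-/ℕ m (suc d)))) (i<j⇒i≤pred[j] k<1+q)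
    where
    q : ℤ
    q = m /ℕ suc d
    k<1+q : k < 1+ q
    k<1+q = *-cancelʳ-<-nonNeg (+ suc d) (≤-<-trans kd≤m (n<s[n/ℕd]*d m (suc d)))

  ceiling-as-div : ∀ (p : ℚ) → ceiling p ≡ - ((- ↥ p) div ↧ p)
  ceiling-as-div (mkℚ -[1+ n ] d c) = refl
  ceiling-as-div (mkℚ (+ 0) d c) = refl
  ceiling-as-div (mkℚ +[1+ n ] d c) = refl

  ceiling-≤ : ∀ (p : ℚ) (η : ℤ) → ↥ p ≤ η * ↧ p → ceiling p ≤ η
  ceiling-≤ p@(mkℚ n d c) η n≤ηd = begin
    ceiling p            ≡⟨ ceiling-as-div p ⟩
    - ((- n) div + suc d) ≤⟨ neg-mono-≤ (≤-floorDiv (- η) (- n) d ηd≤n) ⟩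
    - - η                ≡⟨ neg-involutive η ⟩
    η                    ∎
    where
    open ≤-Reasoning
    ηd≤n : - η * + suc d ≤ - n
    ηd≤n = subst (_≤ - n) (neg-distribˡ-* η (+ suc d)) (neg-mono-≤ n≤ηd)

  -- ⌈x / (d+1)⌉ ≤ η whenever x ≤ η (d+1); the gcd removed by normalisation cancels.
  ceiling-/-≤ : ∀ (x η : ℤ) (d : ℕ) → x ≤ η * + suc d → ceiling (x / suc d) ≤ η
  ceiling-/-≤ x η d x≤ηd = ceiling-≤ p η (cancel-gcd g≢0 scaled)
    where
    p : ℚ
    p = x / suc d
    g : ℕ
    g = ℕ.gcd ℤ.∣ x ∣ (suc d)
    g≢0 : g ≢ 0
    g≢0 = ℕ.gcd[m,n]≢0 ℤ.∣ x ∣ (suc d) (inj₂ (λ ()))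
    scaled : ↥ p * + g ≤ (η * ↧ p) * + g
    scaled = subst₂ _≤_ (sym (↥-/ x (suc d)))
               (trans (cong (η *_) (sym (↧-/ x (suc d)))) (sym (*-assoc η (↧ p) (+ g)))) x≤ηd
    cancel-gcd : ∀ {i j : ℤ} {k : ℕ} → k ≢ 0 → i * + k ≤ j * + k → i ≤ j
    cancel-gcd {k = 0} k≢0 _ = ⊥-elim (k≢0 refl)
    cancel-gcd {i} {j} {suc k} _ le = *-cancelʳ-≤-pos i j (+ suc k) le

module VertexSums where
  open import Data.Nat using (ℕ; zero; suc; _+_; _≤_; z≤n)
  open import Data.Nat.Properties using (+-*-semiring; +-mono-≤; +-identityʳ)
  open import Data.Bool using (Bool; true; false; if_then_else_)
  open import Data.Fin using (Fin; zero; suc; _≟_)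
  open import Data.Fin.Subset using (Subset; ∣_∣)
  open import Data.Vec using (_∷_; []; lookup)
  open import Data.List using (allFin; map; tabulate)
  open import Data.List.Properties using (map-tabulate)
  import Data.Nat.ListAction as List
  open import Relation.Nullary using (does)
  open import Relation.Binary.PropositionalEquality
  open import Algebra.Properties.Semiring.Sum +-*-semiring public
    using (sum; sum-cong-≗; ∑-distrib-+; *-distribˡ-sum; sum-replicate-zero)

  when : Bool → ℕ → ℕ
  when b x = if b then x else 0

  listSum-allFin : ∀ {n} (f : Fin n → ℕ) → List.sum (map f (allFin n)) ≡ sum f
  listSum-allFin f = trans (cong List.sum (map-tabulate (λ i → i) f)) (sum-tabulate f)
    where
    sum-tabulate : ∀ {n} (f : Fin n → ℕ) → List.sum (tabulate f) ≡ sum f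
    sum-tabulate {zero} f = refl
    sum-tabulate {suc n} f = cong (f zero +_) (sum-tabulate (λ i → f (suc i)))

  sum-mono : ∀ {n} {f g : Fin n → ℕ} → (∀ i → f i ≤ g i) → sum f ≤ sum g
  sum-mono {zero} f≤g = z≤n
  sum-mono {suc n} f≤g = +-mono-≤ (f≤g zero) (sum-mono (λ i → f≤g (suc i)))

  sum-point : ∀ {n} (u : Fin n) (g : Fin n → ℕ) → sum (λ v → when (does (v ≟ u)) (g v)) ≡ g u
  sum-point {suc n} zero g = trans (cong (g zero +_) (sum-replicate-zero n)) (+-identityʳ (g zero))
  sum-point {suc n} (suc u) g = sum-point u (λ v → g (suc v))

  card-as-sum : ∀ {n} (Q : Subset n) → ∣ Q ∣ ≡ sum (λ v → when (lookup Q v) 1)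
  card-as-sum [] = refl
  card-as-sum (true ∷ Q) = cong suc (card-as-sum Q)
  card-as-sum (false ∷ Q) = card-as-sum Q

module Pigeonhole where
  open import Data.Nat using (ℕ; zero; suc; _+_; _≤_; _<_; s≤s)
  open import Data.Nat.Properties using (≤-trans; ≤-reflexive; n≤1+n; ≤∧≢⇒<; ≤⇒≯; +-suc; +-identityʳ)
    renaming (_≟_ to _≟ℕ_)
  open import Data.Bool using (true; false)
  open import Data.Fin using (Fin; zero; suc)
  open import Data.Fin.Subset using (Subset; _∈_; _∉_; _-_; ∣_∣; ⁅_⁆; Empty)
  open import Data.Fin.Subset.Properties using (_∈?_; p─⊥≡p; p─q⊆p; Empty-unique; ∣⊥∣≡0)
  open import Data.Fin.Properties using (any?)
  open import Data.Vec.Base using (_∷_; here; there)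
  open import Data.Product using (_×_; _,_)
  open import Relation.Nullary using (yes; no)
  open import Relation.Nullary.Decidable using (_×-dec_)
  open import Function using (_∘_)
  open import Relation.Binary.PropositionalEquality

  InjectiveOn : ∀ {n} → (Fin n → ℕ) → Subset n → Set
  InjectiveOn f Q = ∀ {u v} → u ∈ Q → v ∈ Q → f u ≡ f v → u ≡ v

  ∣p∣≡1+∣p-x∣ : ∀ {n} {x : Fin n} {p : Subset n} → x ∈ p → ∣ p ∣ ≡ suc ∣ p - x ∣
  ∣p∣≡1+∣p-x∣ {p = true ∷ p} here = cong (suc ∘ ∣_∣) (sym (p─⊥≡p p))
  ∣p∣≡1+∣p-x∣ {p = true ∷ p} (there x∈p) = cong suc (∣p∣≡1+∣p-x∣ x∈p)
  ∣p∣≡1+∣p-x∣ {p = false ∷ p} (there x∈p) = ∣p∣≡1+∣p-x∣ x∈p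

  x∉p-x : ∀ {n} (x : Fin n) (p : Subset n) → x ∉ p - x
  x∉p-x zero (true ∷ p) ()
  x∉p-x zero (false ∷ p) ()
  x∉p-x (suc x) (true ∷ p) (there x∈p-x) = x∉p-x x p x∈p-x
  x∉p-x (suc x) (false ∷ p) (there x∈p-x) = x∉p-x x p x∈p-x

  narrow : ∀ {a k x} → a ≤ x × x < a + suc k → x ≢ a → suc a ≤ x × x < suc a + k
  narrow {a} {k} {x} (a≤x , x<) x≢a = ≤∧≢⇒< a≤x (x≢a ∘ sym) , subst (x <_) (+-suc a k) x<

  -- Induction on k: the value a is taken by at most one vertex of Q; discarding it
  -- leaves an injection into [a+1, a+1+k).
  injective-into-interval : ∀ {n} (f : Fin n → ℕ) (Q : Subset n) → InjectiveOn f Q →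
    ∀ k a → (∀ {v} → v ∈ Q → a ≤ f v × f v < a + k) → ∣ Q ∣ ≤ k
  injective-into-interval {n} f Q inj zero a range =
    ≤-reflexive (trans (cong ∣_∣ (Empty-unique empty)) (∣⊥∣≡0 n))
    where
    empty : Empty Q
    empty (v , v∈Q) with range v∈Q
    ... | a≤fv , fv<a+0 = ≤⇒≯ a≤fv (subst (f v <_) (+-identityʳ a) fv<a+0)
  injective-into-interval f Q inj (suc k) a range with any? (λ v → (v ∈? Q) ×-dec (f v ≟ℕ a))
  ... | yes (v , v∈Q , fv≡a) = subst (_≤ suc k) (sym (∣p∣≡1+∣p-x∣ v∈Q)) (s≤s ∣Q-v∣≤k)
    where
    ⊆Q : ∀ {w} → w ∈ Q - v → w ∈ Q
    ⊆Q = p─q⊆p Q ⁅ v ⁆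
    range′ : ∀ {w} → w ∈ Q - v → suc a ≤ f w × f w < suc a + k
    range′ {w} w∈ = narrow (range (⊆Q w∈)) λ fw≡a →
      x∉p-x v Q (subst (_∈ Q - v) (inj (⊆Q w∈) v∈Q (trans fw≡a (sym fv≡a))) w∈)
    ∣Q-v∣≤k : ∣ Q - v ∣ ≤ k
    ∣Q-v∣≤k = injective-into-interval f (Q - v) (λ w∈ w′∈ → inj (⊆Q w∈) (⊆Q w′∈)) k (suc a) range′
  ... | no ∄ = ≤-trans (injective-into-interval f Q inj k (suc a) range′) (n≤1+n k)
    where
    range′ : ∀ {w} → w ∈ Q → suc a ≤ f w × f w < suc a + k
    range′ {w} w∈Q = narrow (range w∈Q) (λ fw≡a → ∄ (w , w∈Q , fw≡a))

-- Neighbourhood bookkeeping around a clique Q.  For u ∈ Q every other vertex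
-- of Q is a neighbour, so the neighbourhood of u is (Q - u) ∪ (outer neighbours).
module CliqueNeighbourhood {n : ℕ} (G : Graph n) (Q : Subset n) (isClique : IsClique G Q) where
  open import Data.Nat using (ℕ; _+_; _*_; _∸_; _≤_; _<_; z≤n)
  open import Data.Nat.Properties
    using (+-comm; +-identityʳ; *-identityʳ; +-cancelʳ-≡; m+n∸m≡n; m+[n∸m]≡n; m≤m+n;
           ≤-trans; <⇒≤; ≤-<-trans; <-≤-trans; +-mono-≤; +-monoˡ-≤; +-monoʳ-≤; +-mono-≤-<;
           *-monoʳ-≤; ∸-monoˡ-≤; ∸-monoʳ-<; m≤o∸n⇒m+n≤o; module ≤-Reasoning)
  open import Data.Nat.Tactic.RingSolver using (solve-∀)
  open import Data.Bool using (true; false; not)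
  open import Data.Fin using (Fin; _≟_)
  open import Data.Fin.Subset using (Subset; _∈_; ∣_∣)
  open import Data.Vec using (lookup)
  open import Data.Vec.Properties using ([]=⇒lookup; lookup⇒[]=)
  open import Data.Empty using (⊥-elim)
  open import Relation.Nullary using (does; yes; no)
  open import Function using (_∘_)
  open import Data.Product using (_×_; _,_; proj₁; proj₂)
  open import Relation.Binary.PropositionalEquality
  open VertexSums
  open Pigeonhole using (InjectiveOn; injective-into-interval)

  nbrSum : Fin n → (Fin n → ℕ) → ℕ
  nbrSum u g = sum (λ v → when (Adj G u v) (g v))

  cliqueSum : (Fin n → ℕ) → ℕ
  cliqueSum g = sum (λ v → when (lookup Q v) (g v))

  outerSum : Fin n → (Fin n → ℕ) → ℕ
  outerSum u g = sum (λ v → when (not (lookup Q v)) (when (Adj G u v) (g v)))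

  outerDeg : Fin n → ℕ
  outerDeg u = outerSum u (λ _ → 1)

  neighbourhood-split : ∀ {u} → u ∈ Q → ∀ g → nbrSum u g + g u ≡ cliqueSum g + outerSum u g
  neighbourhood-split {u} u∈Q g = begin
    nbrSum u g + g u                 ≡⟨ cong (nbrSum u g +_) (sym (sum-point u g)) ⟩
    sum adjacent + sum atU           ≡⟨ sym (∑-distrib-+ adjacent atU) ⟩
    sum (λ v → adjacent v + atU v)   ≡⟨ sum-cong-≗ pointwise ⟩
    sum (λ v → inQ v + outer v)      ≡⟨ ∑-distrib-+ inQ outer ⟩
    cliqueSum g + outerSum u g       ∎
    where
    open ≡-Reasoning
    adjacent atU inQ outer : Fin n → ℕ
    adjacent v = when (Adj G u v) (g v)
    atU v = when (does (v ≟ u)) (g v)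
    inQ v = when (lookup Q v) (g v)
    outer v = when (not (lookup Q v)) (when (Adj G u v) (g v))
    -- v = u contributes g u on both sides; v ∈ Q - u is adjacent to u by the clique property.
    pointwise : ∀ v → adjacent v + atU v ≡ inQ v + outer v
    pointwise v with v ≟ u
    ... | yes refl rewrite loopless G v | []=⇒lookup u∈Q = +-comm 0 (g v)
    ... | no v≢u with lookup Q v in v∈Q
    ...   | true rewrite isClique u v u∈Q (lookup⇒[]= v Q v∈Q) (v≢u ∘ sym) = refl
    ...   | false = +-comm (when (Adj G u v) (g v)) 0

  deg≡nbrSum : ∀ u → deg G u ≡ nbrSum u (λ _ → 1)
  deg≡nbrSum u = listSum-allFin (λ v → when (Adj G u v) 1)

  luckySum≡ : ∀ ℓ u → luckySum G ℓ u ≡ deg G u + nbrSum u ℓ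
  luckySum≡ ℓ u = cong (deg G u +_) (listSum-allFin (λ v → when (Adj G u v) (ℓ v)))

  deg-in-clique : ∀ {u} → u ∈ Q → deg G u + 1 ≡ ∣ Q ∣ + outerDeg u
  deg-in-clique {u} u∈Q = begin
    deg G u + 1                      ≡⟨ cong (_+ 1) (deg≡nbrSum u) ⟩
    nbrSum u (λ _ → 1) + 1           ≡⟨ neighbourhood-split u∈Q (λ _ → 1) ⟩
    cliqueSum (λ _ → 1) + outerDeg u ≡⟨ cong (_+ outerDeg u) (sym (card-as-sum Q)) ⟩
    ∣ Q ∣ + outerDeg u               ∎
    where open ≡-Reasoning

  outerDeg-in-clique : ∀ {u} → u ∈ Q → outerDeg u ≡ deg G u + 1 ∸ ∣ Q ∣
  outerDeg-in-clique {u} u∈Q =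
    sym (trans (cong (_∸ ∣ Q ∣) (deg-in-clique u∈Q)) (m+n∸m≡n ∣ Q ∣ (outerDeg u)))

  outerDeg≥ : ∀ {u δ} → u ∈ Q → δ ≤ deg G u → δ + 1 ∸ ∣ Q ∣ ≤ outerDeg u
  outerDeg≥ {u} {δ} u∈Q δ≤deg =
    subst (δ + 1 ∸ ∣ Q ∣ ≤_) (sym (outerDeg-in-clique u∈Q)) (∸-monoˡ-≤ ∣ Q ∣ (+-monoˡ-≤ 1 δ≤deg))

  outerDeg≤ : ∀ {u Δ} → u ∈ Q → deg G u ≤ Δ → outerDeg u ≤ Δ + 1 ∸ ∣ Q ∣
  outerDeg≤ {u} {Δ} u∈Q deg≤Δ =
    subst (_≤ Δ + 1 ∸ ∣ Q ∣) (sym (outerDeg-in-clique u∈Q)) (∸-monoˡ-≤ ∣ Q ∣ (+-monoˡ-≤ 1 deg≤Δ))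

  clique-size≤ : ∀ {u} → u ∈ Q → ∣ Q ∣ ≤ deg G u + 1
  clique-size≤ {u} u∈Q = subst (∣ Q ∣ ≤_) (sym (deg-in-clique u∈Q)) (m≤m+n ∣ Q ∣ (outerDeg u))

  -- Fix a labeling ℓ with labels at most η.  The excess of u ∈ Q is the part of
  -- its lucky sum not shared by all vertices of Q (shifted by η to stay in ℕ).
  module Labelled (ℓ : Fin n → ℕ) (η : ℕ) where
    excess : Fin n → ℕ
    excess u = outerDeg u + outerSum u ℓ + (η ∸ ℓ u)

    luckySum-in-clique : ∀ {u} → u ∈ Q → ℓ u ≤ η →
      luckySum G ℓ u + (1 + η) ≡ ∣ Q ∣ + cliqueSum ℓ + excess u
    luckySum-in-clique {u} u∈Q ℓu≤η = begin
      luckySum G ℓ u + (1 + η)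
        ≡⟨ cong₂ (λ s t → s + (1 + t)) (luckySum≡ ℓ u) (sym (m+[n∸m]≡n ℓu≤η)) ⟩
      deg G u + nbrSum u ℓ + (1 + (ℓ u + (η ∸ ℓ u)))
        ≡⟨ regroup (deg G u) (nbrSum u ℓ) (ℓ u) (η ∸ ℓ u) ⟩
      (deg G u + 1) + (nbrSum u ℓ + ℓ u) + (η ∸ ℓ u)
        ≡⟨ cong₂ (λ s t → s + t + (η ∸ ℓ u)) (deg-in-clique u∈Q) (neighbourhood-split u∈Q ℓ) ⟩
      (∣ Q ∣ + outerDeg u) + (cliqueSum ℓ + outerSum u ℓ) + (η ∸ ℓ u)
        ≡⟨ regroup′ ∣ Q ∣ (outerDeg u) (cliqueSum ℓ) (outerSum u ℓ) (η ∸ ℓ u) ⟩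
      ∣ Q ∣ + cliqueSum ℓ + excess u
        ∎
      where
      open ≡-Reasoning
      regroup : ∀ d s l t → d + s + (1 + (l + t)) ≡ (d + 1) + (s + l) + t
      regroup = solve-∀
      regroup′ : ∀ w o c r t → w + o + (c + r) + t ≡ w + c + (o + r + t)
      regroup′ = solve-∀

    -- Adjacent vertices have distinct lucky sums, so distinct vertices of Q have distinct excesses.
    excess-injective : IsDLuckyLabeling G η ℓ → InjectiveOn excess Q
    excess-injective (bounds , lucky) {u} {v} u∈Q v∈Q same with u ≟ v
    ... | yes u≡v = u≡v
    ... | no u≢v = ⊥-elim (lucky u v (isClique u v u∈Q v∈Q u≢v) sameLuckySum)
      where
      open ≡-Reasoning
      sameLuckySum : luckySum G ℓ u ≡ luckySum G ℓ v
      sameLuckySum = +-cancelʳ-≡ (1 + η) _ _ (begin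
        luckySum G ℓ u + (1 + η)        ≡⟨ luckySum-in-clique u∈Q (proj₂ (bounds u)) ⟩
        ∣ Q ∣ + cliqueSum ℓ + excess u  ≡⟨ cong (∣ Q ∣ + cliqueSum ℓ +_) same ⟩
        ∣ Q ∣ + cliqueSum ℓ + excess v  ≡⟨ sym (luckySum-in-clique v∈Q (proj₂ (bounds v))) ⟩
        luckySum G ℓ v + (1 + η)        ∎)

    outerDeg≤outerSum : (∀ v → 1 ≤ ℓ v) → ∀ u → outerDeg u ≤ outerSum u ℓ
    outerDeg≤outerSum 1≤ℓ u = sum-mono pointwise
      where
      pointwise : ∀ v → when (not (lookup Q v)) (when (Adj G u v) 1)
                      ≤ when (not (lookup Q v)) (when (Adj G u v) (ℓ v))
      pointwise v with not (lookup Q v) | Adj G u v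
      ... | true  | true  = 1≤ℓ v
      ... | true  | false = z≤n
      ... | false | _     = z≤n

    outerSum≤η*outerDeg : (∀ v → ℓ v ≤ η) → ∀ u → outerSum u ℓ ≤ η * outerDeg u
    outerSum≤η*outerDeg ℓ≤η u =
      subst (outerSum u ℓ ≤_) (sym (*-distribˡ-sum η outerIndicator)) (sum-mono pointwise)
      where
      outerIndicator : Fin n → ℕ
      outerIndicator v = when (not (lookup Q v)) (when (Adj G u v) 1)
      pointwise : ∀ v → when (not (lookup Q v)) (when (Adj G u v) (ℓ v)) ≤ η * outerIndicator v
      pointwise v with not (lookup Q v) | Adj G u v
      ... | true  | true  = subst (ℓ v ≤_) (sym (*-identityʳ η)) (ℓ≤η v)
      ... | true  | false = z≤n
      ... | false | _     = z≤n

    excess-lower : (∀ v → 1 ≤ ℓ v) → ∀ u → 2 * outerDeg u ≤ excess u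
    excess-lower 1≤ℓ u = begin
      2 * outerDeg u            ≡⟨ cong (outerDeg u +_) (+-identityʳ (outerDeg u)) ⟩
      outerDeg u + outerDeg u   ≤⟨ +-monoʳ-≤ (outerDeg u) (outerDeg≤outerSum 1≤ℓ u) ⟩
      outerDeg u + outerSum u ℓ ≤⟨ m≤m+n _ (η ∸ ℓ u) ⟩
      excess u                  ∎
      where open ≤-Reasoning

    excess-upper : (∀ v → 1 ≤ ℓ v × ℓ v ≤ η) → ∀ u → excess u < outerDeg u + η * outerDeg u + η
    excess-upper bounds u =
      +-mono-≤-< (+-monoʳ-≤ (outerDeg u) (outerSum≤η*outerDeg (proj₂ ∘ bounds) u))
                 (∸-monoʳ-< (proj₁ (bounds u)) (proj₂ (bounds u)))

    -- Counting: the excesses of Q are ∣ Q ∣ distinct numbers in [2 s, M + η M + η),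
    -- where s = δ + 1 ∸ ω and M = Δ + 1 ∸ ω bound the outer degrees on Q.
    clique-count : IsDLuckyLabeling G η ℓ → ∀ {u₀} → u₀ ∈ Q → ∀ δ Δ →
      (∀ u → u ∈ Q → δ ≤ deg G u) → (∀ u → u ∈ Q → deg G u ≤ Δ) →
      let M = Δ + 1 ∸ ∣ Q ∣ in ∣ Q ∣ + 2 * (δ + 1 ∸ ∣ Q ∣) ≤ M + η * M + η
    clique-count lucky@(bounds , _) {u₀} u₀∈Q δ Δ δ≤deg deg≤Δ =
      m≤o∸n⇒m+n≤o ∣ Q ∣ low≤high
        (injective-into-interval excess Q (excess-injective lucky) (high ∸ low) low
          (λ {v} v∈Q → lower v∈Q , subst (excess v <_) (sym (m+[n∸m]≡n low≤high)) (upper v∈Q)))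
      where
      M low high : ℕ
      M = Δ + 1 ∸ ∣ Q ∣
      low = 2 * (δ + 1 ∸ ∣ Q ∣)
      high = M + η * M + η
      lower : ∀ {u} → u ∈ Q → low ≤ excess u
      lower {u} u∈Q =
        ≤-trans (*-monoʳ-≤ 2 (outerDeg≥ u∈Q (δ≤deg u u∈Q))) (excess-lower (proj₁ ∘ bounds) u)
      upper : ∀ {u} → u ∈ Q → excess u < high
      upper {u} u∈Q = <-≤-trans (excess-upper bounds u) (+-monoˡ-≤ η (+-mono-≤ D≤M (*-monoʳ-≤ η D≤M)))
        where
        D≤M : outerDeg u ≤ M
        D≤M = outerDeg≤ u∈Q (deg≤Δ u u∈Q)
      low≤high : low ≤ high
      low≤high = <⇒≤ (≤-<-trans (lower u₀∈Q) (upper u₀∈Q))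

module Arithmetic where
  open import Data.Nat using (ℕ; suc; _+_; _*_; _∸_; _≤_; s≤s⁻¹)
  open import Data.Nat.Properties using (*-monoʳ-≤; +-monoʳ-≤; m≤m+n; m+n∸m≡n; module ≤-Reasoning)
  open import Data.Nat.Tactic.RingSolver using (solve-∀)
  open import Data.Integer as ℤ using (+_; _-_; _⊖_)
  import Data.Integer.Properties as ℤ
  open import Relation.Binary.PropositionalEquality

  bound-from-count : ∀ ω δ Δ η s M → δ + 1 ≤ ω + s → ω + 2 * s ≤ M + η * M + η →
    M + ω ≡ Δ + 1 → 2 * δ + 1 ≤ Δ + η * suc M
  bound-from-count ω δ Δ η s M δ+1≤ω+s count M+ω≡Δ+1 = s≤s⁻¹ (begin
    suc (2 * δ + 1)         ≡⟨ double δ ⟩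
    2 * (δ + 1)             ≤⟨ *-monoʳ-≤ 2 δ+1≤ω+s ⟩
    2 * (ω + s)             ≡⟨ split ω s ⟩
    ω + (ω + 2 * s)         ≤⟨ +-monoʳ-≤ ω count ⟩
    ω + (M + η * M + η)     ≡⟨ regroup ω M η ⟩
    (M + ω) + (η + η * M)   ≡⟨ cong (_+ (η + η * M)) M+ω≡Δ+1 ⟩
    (Δ + 1) + (η + η * M)   ≡⟨ collect Δ η M ⟩
    suc (Δ + η * suc M)     ∎)
    where
    open ≤-Reasoning
    double : ∀ δ → suc (2 * δ + 1) ≡ 2 * (δ + 1)
    double = solve-∀
    split : ∀ ω s → 2 * (ω + s) ≡ ω + (ω + 2 * s)
    split = solve-∀
    regroup : ∀ ω M η → ω + (M + η * M + η) ≡ (M + ω) + (η + η * M)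
    regroup = solve-∀
    collect : ∀ Δ η M → (Δ + 1) + (η + η * M) ≡ suc (Δ + η * suc M)
    collect = solve-∀

  m≤n+o⇒m-n≤o : ∀ m n o → m ≤ n + o → + m - + n ℤ.≤ + o
  m≤n+o⇒m-n≤o m n o m≤n+o = begin
    + m - + n   ≡⟨ ℤ.[+m]-[+n]≡m⊖n m n ⟩
    m ⊖ n       ≤⟨ ℤ.⊖-monoˡ-≤ n m≤n+o ⟩
    (n + o) ⊖ n ≡⟨ ℤ.≤-⊖ (m≤m+n n o) ⟩
    + (n + o ∸ n) ≡⟨ cong +_ (m+n∸m≡n n o) ⟩
    + o         ∎
    where open ℤ.≤-Reasoning

open import Data.Nat using (_+_; _*_; _∸_)
import Data.Nat as ℕ
import Data.Nat.Properties as ℕ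
open import Data.Integer as ℤ using (ℤ; +_; _-_; _≤_)
open import Data.Fin.Subset using (∣_∣; _∈_)
open import Data.Product using (_,_)
open import Data.Integer.Properties using (pos-*)
open import Relation.Binary.PropositionalEquality using (_≡_; cong; subst; trans; sym)
open CeilingBound using (ceiling-/-≤)
open Arithmetic using (bound-from-count; m≤n+o⇒m-n≤o)

labeling-bound : ∀ {n} (G : Graph n) (Q : Subset n) → IsClique G Q →
  ∀ k ℓ → IsDLuckyLabeling G k ℓ → ∀ {u₀} → u₀ ∈ Q → ∀ δ Δ →
  (∀ u → u ∈ Q → δ ℕ.≤ deg G u) → (∀ u → u ∈ Q → deg G u ℕ.≤ Δ) →
  ceilDiv (+ (2 * δ + 1) - + Δ) (Δ + 2 ∸ ∣ Q ∣) ≤ + k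
labeling-bound G Q isClique k ℓ lucky {u₀} u₀∈Q δ Δ δ≤deg deg≤Δ =
  subst (λ d → ceilDiv X d ≤ + k) (sym Δ+2∸ω≡1+M) (ceiling-/-≤ X (+ k) M X≤k[M+1])
  where
  open CliqueNeighbourhood G Q isClique using (clique-size≤; module Labelled)
  X : ℤ
  X = + (2 * δ + 1) - + Δ
  ω M : ℕ
  ω = ∣ Q ∣
  M = Δ + 1 ∸ ω
  count : ω + 2 * (δ + 1 ∸ ω) ℕ.≤ M + k * M + k
  count = Labelled.clique-count ℓ k lucky u₀∈Q δ Δ δ≤deg deg≤Δ
  ω≤Δ+1 : ω ℕ.≤ Δ + 1
  ω≤Δ+1 = ℕ.≤-trans (clique-size≤ u₀∈Q) (ℕ.+-monoˡ-≤ 1 (deg≤Δ u₀ u₀∈Q))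
  Δ+2∸ω≡1+M : Δ + 2 ∸ ω ≡ ℕ.suc M
  Δ+2∸ω≡1+M = trans (cong (_∸ ω) (ℕ.+-suc Δ 1)) (ℕ.+-∸-assoc 1 ω≤Δ+1)
  numerator≤ : 2 * δ + 1 ℕ.≤ Δ + k * ℕ.suc M
  numerator≤ = bound-from-count ω δ Δ k (δ + 1 ∸ ω) M (ℕ.m≤n+m∸n (δ + 1) ω) count (ℕ.m∸n+n≡m ω≤Δ+1)
  X≤k[M+1] : X ≤ + k ℤ.* + ℕ.suc M
  X≤k[M+1] = subst (X ≤_) (pos-* k (ℕ.suc M)) (m≤n+o⇒m-n≤o (2 * δ + 1) Δ (k * ℕ.suc M) numerator≤)

theorem2p1 : ∀ {n} (G : Graph n) → Connected G →
    ∀ (η : ℕ) → IsDLuckyNumber G η →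
    ∀ (Q : Subset n) → IsLargestClique G Q →
    ∀ (δ Δ : ℕ) → IsMinDegOn G Q δ → IsMaxDegOn G Q Δ →
    ceilDiv (+ (2 * δ + 1) - + Δ) (Δ + 2 ∸ ∣ Q ∣) ≤ + η
theorem2p1 G _ η (_ , (ℓ , lucky) , _) Q (isClique , _) δ Δ ((u₀ , u₀∈Q , _) , δ≤deg) (_ , deg≤Δ) =
  labeling-bound G Q isClique η ℓ lucky u₀∈Q δ Δ δ≤deg deg≤Δ
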